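{- Let $X=(V,E)$ be a digraph, let $\mathcal{F}=(V_1,\dots,V_k)$ be a composition of $V$, and let $X_i=X|_{V_i}$, $i=1,\dots,k$. A $V$-listing $\sigma\in\Sigma_V$ is $(\mathcal{F},X)$-friendly if and only if it can be written as a concatenation $\sigma=\sigma^1\cdots\sigma^k$ where each $\sigma^i\in\Sigma_{V_i}$ is a Hamiltonian path of the complementary digraph $\overline{X_i}$. Consequently, \[|\Sigma_V(\mathcal{F},X)|=\zeta([X_1])\cdots\zeta([X_k]),\] where $\zeta([Y])$ denotes the number of $W$-listings $\tau$ of a digraph $Y$ on vertex set $W$ with $Y\mathrm{Des}(\tau)=\emptyset$.
   Context: A digraph is a pair $X=(V,E)$ with $V$ a finite set and $E\subset\{(u,v)\in V\times V\mid u\neq v\}$; $n=|V|$. $\mathbb{P}=\{1,2,3,\dots\}$. A $V$-listing is a bijection $\sigma:[n]\to V$, written $(\sigma_1,\dots,\sigma_n)$; $\Sigma_V$ is the set of $V$-listings. $X\mathrm{Des}(\sigma)=\{1\le i\le n-1\mid(\sigma_i,\sigma_{i+1})\in E\}$. A Hamiltonian path of a digraph $Y$ on $W$ is a $W$-listing $\tau$ with consecutive pairs $(\tau_j,\tau_{j+1})$ all edges of $Y$. The complementary digraph $\overline{X}=(V,E^c)$ has $(u,v)\in E^c$ iff $u\neq v$ and $(u,v)\notin E$. For $S\subset V$, $X|_S=(S,\{(u,v)\in E\mid u,v\in S\})$. For a coloring $f:V\to\mathbb{P}$, $\sigma$ is $(f,X)$-friendly if $f(\sigma_1)\le\cdots\le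 f(\sigma_n)$ and $f(\sigma_j)<f(\sigma_{j+1})$ whenever $(\sigma_j,\sigma_{j+1})\in E$. A composition of $V$ is an ordered tuple $(V_1,\dots,V_k)$ of disjoint nonempty subsets with union $V$. A coloring $f$ is an $\mathcal{F}$-coloring if $f$ is constant on each block and strictly smaller on earlier blocks than on later ones. $\sigma$ is $(\mathcal{F},X)$-friendly if it is $(f,X)$-friendly for some $\mathcal{F}$-coloring $f$ (equivalently for every one); $\Sigma_V(\mathcal{F},X)$ is the set of such listings. -}

module Defs where

open import Level using (0ℓ)
open import Data.Nat using (ℕ; _≤_; _<_)
open import Data.Fin as Fin using (Fin)
open import Data.List using (List; length; concat; map; allFin)
open import Data.List.Membership.Propositional using (_∈_)
open import Data.List.Relation.Unary.Unique.Propositional using (Unique)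
open import Data.List.Relation.Unary.Linked using (Linked)
open import Data.Product using (Σ; ∃; ∃-syntax; _×_; _,_; proj₁; proj₂)
open import Data.Unit using (⊤)
open import Relation.Nullary using (¬_)
open import Relation.Binary.PropositionalEquality using (_≡_; _≢_)
open import Function.Bundles using (_⇔_)

-- A digraph whose vertex set is a subset W = {v | vert v} of an ambient Fin n.
-- Edges are ordered pairs of distinct vertices of W.
record Digraph (n : ℕ) : Set₁ where
  field
    vert : Fin n → Set
    edge : Fin n → Fin n → Set
    wf   : ∀ {u v} → edge u v → vert u × vert v × u ≢ v
open Digraph public

mkDigraph : ∀ {n} (E : Fin n → Fin n → Set) → (∀ {u v} → E u v → u ≢ v) → Digraph n
mkDigraph E irr = record
  { vert = λ _ → ⊤
  ; edge = E
  ; wf   = λ e → _ , _ , irr e }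

restrict : ∀ {n} → Digraph n → (Fin n → Set) → Digraph n
restrict X S = record
  { vert = λ v → vert X v × S v
  ; edge = λ u v → edge X u v × S u × S v
  ; wf   = λ { (e , su , sv) → let r = wf X e in (proj₁ r , su) , (proj₁ (proj₂ r) , sv) , proj₂ (proj₂ r) } }

complement : ∀ {n} → Digraph n → Digraph n
complement X = record
  { vert = vert X
  ; edge = λ u v → vert X u × vert X v × u ≢ v × ¬ edge X u v
  ; wf   = λ { (xu , xv , d , _) → xu , xv , d } }

-- A W-listing: a list enumerating each element of W exactly once
-- (i.e. a bijection [m] → W written as a word).
Listing : ∀ {n} → (Fin n → Set) → List (Fin n) → Set
Listing W τ = Unique τ × (∀ v → (v ∈ τ) ⇔ W v)

HamPath : ∀ {n} → Digraph n → List (Fin n) → Set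
HamPath Y τ = Listing (vert Y) τ × Linked (edge Y) τ

-- Y Des(τ) = ∅ : no consecutive pair (τ_j, τ_{j+1}) is an edge of Y.
NoDescent : ∀ {n} → Digraph n → List (Fin n) → Set
NoDescent Y τ = Linked (λ u v → ¬ edge Y u v) τ

-- A composition (V_1,…,V_k) of V = Fin n is encoded by the block map
-- b : Fin n → Fin k (v ∈ V_i iff b v ≡ i), required to be surjective
-- (blocks nonempty).
Block : ∀ {n k} → (Fin n → Fin k) → Fin k → Fin n → Set
Block b i v = b v ≡ i

IsComposition : ∀ {n k} → (Fin n → Fin k) → Set
IsComposition b = ∀ i → ∃[ v ] b v ≡ i

FColoring : ∀ {n k} → (Fin n → Fin k) → (Fin n → ℕ) → Set
FColoring b f =
  (∀ v → 1 ≤ f v) ×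
  (∀ u v → b u ≡ b v → f u ≡ f v) ×
  (∀ u v → b u Fin.< b v → f u < f v)

Friendly : ∀ {n} → Digraph n → (Fin n → ℕ) → List (Fin n) → Set
Friendly X f σ = Linked (λ u v → f u ≤ f v × (edge X u v → f u < f v)) σ

FFriendly : ∀ {n k} → Digraph n → (Fin n → Fin k) → List (Fin n) → Set
FFriendly X b σ = ∃[ f ] FColoring b f × Friendly X f σ

HasCard : ∀ {n} → (List (Fin n) → Set) → ℕ → Set
HasCard P m = ∃[ L ] Unique L × length L ≡ m × (∀ σ → (σ ∈ L) ⇔ P σ)

{-# OPTIONS --safe #-}
-- An F-coloring increases strictly from block to block, so along an (F,X)-friendly listing the
-- block index never decreases: the listing is the concatenation of its restrictions to V₁, …, V_k.
-- Inside a block the color is constant, so friendliness there says exactly that no consecutive pair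
-- is an edge of X, i.e. that the restriction is a Hamiltonian path of the complement of X_i.
-- Conversely the block index is itself an F-coloring, for which every such concatenation is
-- friendly. Since the blocks are disjoint, a concatenation determines its pieces, so friendly
-- listings correspond to k-tuples of descent-free listings of the blocks.
module Submission where

open import Defs
open import Data.Nat using (ℕ; zero; suc; _+_; _*_; _≤_; _<_; z≤n; s≤s)
import Data.Nat.Properties as ℕ
open import Data.Nat.ListAction using (product)
open import Data.Fin as F using (Fin; toℕ)
import Data.Fin.Properties as F
open import Data.List
  using (List; []; _∷_; _++_; [_]; concat; map; allFin; filter; length; cartesianProductWith)
import Data.List.Properties as List
open import Data.List.Membership.Propositional using (_∈_)
open import Data.List.Membership.Propositional.Properties
  using (∈-allFin; ∈-map⁺; ∈-map⁻; ∈-concat⁺′; ∈-concat⁻′; ∈-concatMap⁻; ∈-filter⁺; ∈-filter⁻;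
         ∈-cartesianProductWith⁺; ∈-cartesianProductWith⁻)
open import Data.List.Relation.Unary.Any as Any using (here; there)
open import Data.List.Relation.Unary.All as All using (All; []; _∷_)
import Data.List.Relation.Unary.All.Properties as All
open import Data.List.Relation.Unary.AllPairs using (AllPairs; []; _∷_)
import Data.List.Relation.Unary.AllPairs.Properties as AllPairs
open import Data.List.Relation.Unary.Linked as Linked using (Linked; []; [-]; _∷_)
import Data.List.Relation.Unary.Linked.Properties as Linked
open import Data.List.Relation.Unary.Unique.Propositional using (Unique)
import Data.List.Relation.Unary.Unique.Propositional.Properties as Unique
open import Data.List.Relation.Binary.Disjoint.Propositional using (Disjoint)
import Data.Vec.Functional as Vector
open import Data.Product using (∃-syntax; _×_; _,_; proj₁; proj₂)
import Data.Product as Product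
open import Data.Unit using (⊤)
open import Relation.Nullary using (¬_; yes; no; contradiction)
open import Relation.Unary using (Decidable)
open import Relation.Binary.PropositionalEquality
  using (_≡_; _≢_; refl; sym; trans; cong; cong₂; subst; subst₂; module ≡-Reasoning)
open import Function using (_∘_; _∘₂_)
open import Function.Bundles using (_⇔_; mk⇔; Equivalence)
import Function.Properties.Equivalence as ⇔

open Equivalence using (to; from)

module _ {A : Set} {R : A → A → Set} where

  Linked-++⁺ : ∀ {xs ys} → Linked R xs → Linked R ys →
               (∀ {x y} → x ∈ xs → y ∈ ys → R x y) → Linked R (xs ++ ys)
  Linked-++⁺ []               Rys _     = Rys
  Linked-++⁺ {ys = []}    [-] _   _     = [-]
  Linked-++⁺ {ys = _ ∷ _} [-] Rys cross = cross (here refl) (here refl) ∷ Rys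
  Linked-++⁺ (Rxy ∷ Rxs)      Rys cross = Rxy ∷ Linked-++⁺ Rxs Rys (cross ∘ there)

  Linked-++⁻ : ∀ xs {ys} → Linked R (xs ++ ys) → Linked R xs × Linked R ys
  Linked-++⁻ []                    Rys         = [] , Rys
  Linked-++⁻ (_ ∷ [])     {[]}    _           = [-] , []
  Linked-++⁻ (_ ∷ [])     {_ ∷ _} (_ ∷ Rys)   = [-] , Rys
  Linked-++⁻ (_ ∷ _ ∷ xs)         (Rxy ∷ Rxs) = Product.map₁ (Rxy ∷_) (Linked-++⁻ (_ ∷ xs) Rxs)

  Linked-concat⁺ : ∀ {xss} → All (Linked R) xss →
                   AllPairs (λ xs ys → ∀ {x y} → x ∈ xs → y ∈ ys → R x y) xss →
                   Linked R (concat xss)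
  Linked-concat⁺ []           []                = []
  Linked-concat⁺ (Rxs ∷ Rxss) (cross ∷ crosses) =
    Linked-++⁺ Rxs (Linked-concat⁺ Rxss crosses) λ x∈xs y∈ →
      let ys , y∈ys , ys∈ = ∈-concat⁻′ _ y∈ in All.lookup cross ys∈ x∈xs y∈ys

  Linked-concat⁻ : ∀ xss → Linked R (concat xss) → All (Linked R) xss
  Linked-concat⁻ []         _  = []
  Linked-concat⁻ (xs ∷ xss) Rc =
    let Rxs , Rrest = Linked-++⁻ xs Rc in Rxs ∷ Linked-concat⁻ xss Rrest

Linked-strengthen : ∀ {A : Set} {P : A → Set} {S R : A → A → Set} {xs} →
                    All P xs → AllPairs S xs → Linked R xs →
                    Linked (λ x y → P x × P y × S x y × R x y) xs
Linked-strengthen _                   _                 []          = []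
Linked-strengthen _                   _                 [-]         = [-]
Linked-strengthen (Px ∷ Pys@(Py ∷ _)) ((Sxy ∷ _) ∷ Sys) (Rxy ∷ Rys) =
  (Px , Py , Sxy , Rxy) ∷ Linked-strengthen Pys Sys Rys

map-allFin-suc : ∀ {B : Set} {k} (τ : Fin (suc k) → B) →
                 map τ (allFin (suc k)) ≡ τ F.zero ∷ map (τ ∘ F.suc) (allFin k)
map-allFin-suc τ = cong (τ F.zero ∷_)
  (trans (List.map-tabulate F.suc τ) (sym (List.map-tabulate (λ i → i) (τ ∘ F.suc))))

All-map-allFin⁺ : ∀ {B : Set} {P : B → Set} {k} {τ : Fin k → B} →
                  (∀ i → P (τ i)) → All P (map τ (allFin k))
All-map-allFin⁺ Pτ = All.map⁺ (All.tabulate⁺ Pτ)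

module _ {A : Set} {k : ℕ} (key : A → Fin k) where

  blockOf : Fin k → List A → List A
  blockOf i = filter (λ x → key x F.≟ i)

  SplitsIntoBlocks : List A → Set
  SplitsIntoBlocks xs = ∀ {js} → AllPairs F._<_ js → All (λ x → key x ∈ js) xs →
                        xs ≡ concat (map (λ i → blockOf i xs) js)

  -- Either x belongs to the first block j, or that block is empty and j can be dropped.
  ∷-splitsIntoBlocks : ∀ {x xs} → All (λ y → key x F.≤ key y) xs →
                       SplitsIntoBlocks xs → SplitsIntoBlocks (x ∷ xs)
  ∷-splitsIntoBlocks _ _ {[]} _ (() ∷ _)
  ∷-splitsIntoBlocks {x} {xs} x≤xs split {j ∷ js} (j<js ∷ js↗) (x∈ ∷ xs∈) with key x F.≟ j
  ... | yes refl = cong (x ∷_) (trans (split (j<js ∷ js↗) xs∈)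
    (cong (λ bs → blockOf j xs ++ concat bs) (List.map-cong-local (All.map x∉ j<js))))
    where
    x∉ : ∀ {i} → j F.< i → blockOf i xs ≡ blockOf i (x ∷ xs)
    x∉ {i} j<i = sym (List.filter-reject (λ y → key y F.≟ i) (F.<⇒≢ j<i))
  ... | no x∉j = trans
    (∷-splitsIntoBlocks x≤xs split js↗
      (x∈js ∷ All.zipWith (λ (y∈ , x≤y) → Any.tail (≢j x≤y) y∈) (xs∈ , x≤xs)))
    (cong (_++ _) (sym (List.filter-none (λ y → key y F.≟ j) (All.map ≢j x≤xs))))
    where
    x∈js : key x ∈ js
    x∈js = Any.tail x∉j x∈
    ≢j : ∀ {y} → key x F.≤ key y → key y ≢ j
    ≢j x≤y = F.<⇒≢ (ℕ.<-≤-trans (All.lookup j<js x∈js) x≤y) ∘ sym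

  sorted⇒splitsIntoBlocks : ∀ {xs} → AllPairs (λ x y → key x F.≤ key y) xs → SplitsIntoBlocks xs
  sorted⇒splitsIntoBlocks []           {[]}    _         _ = refl
  sorted⇒splitsIntoBlocks []           {_ ∷ _} (_ ∷ js↗) _ = sorted⇒splitsIntoBlocks [] js↗ []
  sorted⇒splitsIntoBlocks (x≤xs ∷ xs↗) = ∷-splitsIntoBlocks x≤xs (sorted⇒splitsIntoBlocks xs↗)

length-cartesianProductWith : ∀ {A B C : Set} (f : A → B → C) xs ys →
                              length (cartesianProductWith f xs ys) ≡ length xs * length ys
length-cartesianProductWith f []       ys = refl
length-cartesianProductWith f (x ∷ xs) ys = begin
  length (map (f x) ys ++ cartesianProductWith f xs ys)
    ≡⟨ List.length-++ (map (f x) ys) ⟩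
  length (map (f x) ys) + length (cartesianProductWith f xs ys)
    ≡⟨ cong₂ _+_ (List.length-map (f x) ys) (length-cartesianProductWith f xs ys) ⟩
  length ys + length xs * length ys
    ∎
  where open ≡-Reasoning

Concatenation : ∀ {A : Set} {k} → (Fin k → List A → Set) → List A → Set
Concatenation {k = k} P σ = ∃[ τ ] (σ ≡ concat (map τ (allFin k))) × (∀ i → P i (τ i))

Concatenation-cong : ∀ {A : Set} {k} {P Q : Fin k → List A → Set} {σ} →
                     (∀ i t → P i t ⇔ Q i t) → Concatenation P σ ⇔ Concatenation Q σ
Concatenation-cong P⇔Q = mk⇔ (Product.map₂ (Product.map₂ λ Pτ i → to (P⇔Q i _) (Pτ i)))
                             (Product.map₂ (Product.map₂ λ Qτ i → from (P⇔Q i _) (Qτ i)))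

module _ {A : Set} where

  ++-prefix-unique : ∀ {P : A → Set} {t t′ s s′} → All P t → All P t′ →
                     All (¬_ ∘ P) s → All (¬_ ∘ P) s′ → t ++ s ≡ t′ ++ s′ → t ≡ t′
  ++-prefix-unique {t = []}    {[]}    _ _ _ _ _ = refl
  ++-prefix-unique {t = []}    {_ ∷ _} _ (Px ∷ _) (¬Px ∷ _) _ refl = contradiction Px ¬Px
  ++-prefix-unique {t = _ ∷ _} {[]}    (Px ∷ _) _ _ (¬Px ∷ _) refl = contradiction Px ¬Px
  ++-prefix-unique {t = _ ∷ _} {_ ∷ _} (_ ∷ Pt) (_ ∷ Pt′) ¬Ps ¬Ps′ eq =
    let x≡x′ , eq′ = List.∷-injective eq in cong₂ _∷_ x≡x′ (++-prefix-unique Pt Pt′ ¬Ps ¬Ps′ eq′)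

  Unique-cartesianProductWith-++ : ∀ {T S : List (List A)} →
    (∀ {t t′ s s′} → t ∈ T → t′ ∈ T → s ∈ S → s′ ∈ S → t ++ s ≡ t′ ++ s′ → t ≡ t′) →
    Unique T → Unique S → Unique (cartesianProductWith _++_ T S)
  Unique-cartesianProductWith-++ {[]}        _      _          _  = []
  Unique-cartesianProductWith-++ {t ∷ T} {S} prefix (t∉T ∷ T!) S! =
    Unique.++⁺ (Unique.map⁺ (List.++-cancelˡ t _ _) S!)
               (Unique-cartesianProductWith-++ (λ t∈ t′∈ → prefix (there t∈) (there t′∈)) T! S!)
               disjoint
    where
    disjoint : Disjoint (map (t ++_) S) (cartesianProductWith _++_ T S)
    disjoint (v∈tS , v∈TS) with ∈-map⁻ (t ++_) v∈tS | ∈-cartesianProductWith⁻ _++_ T S v∈TS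
    ... | s , s∈ , refl | t′ , s′ , t′∈ , s′∈ , eq =
      All.lookup t∉T t′∈ (prefix (here refl) (there t′∈) s∈ s′∈ eq)

  concatenations : ∀ {k} → (Fin k → List (List A)) → List (List A)
  concatenations {zero}  L = [ [] ]
  concatenations {suc k} L = cartesianProductWith _++_ (L F.zero) (concatenations (L ∘ F.suc))

  ∈-concatenations⁺ : ∀ {k} {L : Fin k → List (List A)} {σ} →
                      Concatenation (λ i → _∈ L i) σ → σ ∈ concatenations L
  ∈-concatenations⁺ {zero}      (_ , refl , _)   = here refl
  ∈-concatenations⁺ {suc k} {L} (τ , refl , τ∈L) =
    subst (_∈ concatenations L) (sym (cong concat (map-allFin-suc τ)))
      (∈-cartesianProductWith⁺ _++_ (τ∈L F.zero) (∈-concatenations⁺ (τ ∘ F.suc , refl , τ∈L ∘ F.suc)))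

  ∈-concatenations⁻ : ∀ {k} {L : Fin k → List (List A)} {σ} →
                      σ ∈ concatenations L → Concatenation (λ i → _∈ L i) σ
  ∈-concatenations⁻ {zero}      (here refl) = (λ ()) , refl , (λ ())
  ∈-concatenations⁻ {suc k} {L} σ∈ with ∈-cartesianProductWith⁻ _++_ (L F.zero) _ σ∈
  ... | t , s , t∈ , s∈ , refl with ∈-concatenations⁻ s∈
  ... | τ , s≡ , τ∈L =
    t Vector.∷ τ ,
    trans (cong (t ++_) s≡) (sym (cong concat (map-allFin-suc (t Vector.∷ τ)))) ,
    λ { F.zero → t∈ ; (F.suc i) → τ∈L i }

  ∈-concatenations⇔ : ∀ {k} {L : Fin k → List (List A)} {σ} →
                      σ ∈ concatenations L ⇔ Concatenation (λ i → _∈ L i) σ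
  ∈-concatenations⇔ = mk⇔ ∈-concatenations⁻ ∈-concatenations⁺

  length-concatenations : ∀ {k} (L : Fin k → List (List A)) →
                          length (concatenations L) ≡ product (map (length ∘ L) (allFin k))
  length-concatenations {zero}  L = refl
  length-concatenations {suc k} L = begin
    length (concatenations L)
      ≡⟨ length-cartesianProductWith _++_ (L F.zero) _ ⟩
    length (L F.zero) * length (concatenations (L ∘ F.suc))
      ≡⟨ cong (length (L F.zero) *_) (length-concatenations (L ∘ F.suc)) ⟩
    product (length (L F.zero) ∷ map (length ∘ L ∘ F.suc) (allFin k))
      ≡⟨ cong product (map-allFin-suc (length ∘ L)) ⟨
    product (map (length ∘ L) (allFin (suc k)))
      ∎
    where open ≡-Reasoning

  Unique-concatenations : ∀ {k} {L : Fin k → List (List A)} (Q : Fin k → A → Set) →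
    (∀ {i j v} → Q i v → Q j v → i ≡ j) → (∀ {i t} → t ∈ L i → All (Q i) t) →
    (∀ i → Unique (L i)) → Unique (concatenations L)
  Unique-concatenations {zero}      _ _          _   _  = [] ∷ []
  Unique-concatenations {suc k} {L} Q Q-disjoint L⊆Q L! =
    Unique-cartesianProductWith-++
      (λ t∈ t′∈ s∈ s′∈ → ++-prefix-unique (L⊆Q t∈) (L⊆Q t′∈) (avoidsQ₀ s∈) (avoidsQ₀ s′∈))
      (L! F.zero)
      (Unique-concatenations (Q ∘ F.suc) (F.suc-injective ∘₂ Q-disjoint) L⊆Q (L! ∘ F.suc))
    where
    avoidsQ₀ : ∀ {s} → s ∈ concatenations (L ∘ F.suc) → All (¬_ ∘ Q F.zero) s
    avoidsQ₀ s∈ with ∈-concatenations⁻ {L = L ∘ F.suc} s∈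
    ... | τ , s≡ , τ∈L = subst (All _) (sym s≡) (All.concat⁺ (All-map-allFin⁺ λ i →
      All.map (λ Qᵢv Q₀v → F.0≢1+n (Q-disjoint Q₀v Qᵢv)) (L⊆Q (τ∈L i))))

Listing⇒All : ∀ {n} {W : Fin n → Set} {σ} → Listing W σ → All W σ
Listing⇒All (_ , σ⇔W) = All.tabulate λ {v} → to (σ⇔W v)

Listing-filter : ∀ {n} {W P : Fin n → Set} (P? : Decidable P) {σ} →
                 Listing W σ → Listing (λ v → W v × P v) (filter P? σ)
Listing-filter P? (σ! , σ⇔W) =
  Unique.filter⁺ P? σ! ,
  λ v → mk⇔ (λ v∈ → let v∈σ , Pv = ∈-filter⁻ P? v∈ in to (σ⇔W v) v∈σ , Pv)
            (λ (Wv , Pv) → ∈-filter⁺ P? (from (σ⇔W v) Wv) Pv)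

Listing-concat-blocks : ∀ {n k} {W : Fin n → Set} (b : Fin n → Fin k) {τ : Fin k → List (Fin n)} →
                        (∀ i → Listing (λ v → W v × b v ≡ i) (τ i)) →
                        Listing W (concat (map τ (allFin k)))
Listing-concat-blocks {k = k} {W} b {τ} τ-listing =
  Unique.concat⁺ (All-map-allFin⁺ (proj₁ ∘ τ-listing)) (AllPairs.map⁺ (AllPairs.tabulate⁺ disjoint)) ,
  λ v → mk⇔ (λ v∈ → proj₁ (inBlock (proj₂ (Any.satisfied (∈-concatMap⁻ τ {xs = allFin k} v∈)))))
            (λ Wv → ∈-concat⁺′ (from (proj₂ (τ-listing (b v)) v) (Wv , refl))
                               (∈-map⁺ τ (∈-allFin (b v))))
  where
  inBlock : ∀ {i v} → v ∈ τ i → W v × b v ≡ i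
  inBlock {i} {v} = to (proj₂ (τ-listing i) v)
  disjoint : ∀ {i j} → i ≢ j → Disjoint (τ i) (τ j)
  disjoint i≢j (v∈τᵢ , v∈τⱼ) = i≢j (trans (sym (proj₂ (inBlock v∈τᵢ))) (proj₂ (inBlock v∈τⱼ)))

HasCard-resp-⇔ : ∀ {n m} {P Q : List (Fin n) → Set} →
                 (∀ σ → P σ ⇔ Q σ) → HasCard P m → HasCard Q m
HasCard-resp-⇔ P⇔Q (L , L! , |L| , ∈L⇔P) = L , L! , |L| , λ σ → ⇔.trans (∈L⇔P σ) (P⇔Q σ)

HasCard-Concatenation : ∀ {n k} (b : Fin n → Fin k) {P : Fin k → List (Fin n) → Set} {ζ : Fin k → ℕ} →
                        (∀ {i t} → P i t → All (λ v → b v ≡ i) t) → (∀ i → HasCard (P i) (ζ i)) →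
                        HasCard (Concatenation P) (product (map ζ (allFin k)))
HasCard-Concatenation {k = k} b {P} {ζ} P⊆block card =
  concatenations L ,
  Unique-concatenations (λ i v → b v ≡ i) (λ bv≡i bv≡j → trans (sym bv≡i) bv≡j)
                        (λ {i} t∈ → P⊆block (to (∈L⇔P i _) t∈)) L! ,
  trans (length-concatenations L) (cong product (List.map-cong |L| (allFin k))) ,
  λ σ → ⇔.trans ∈-concatenations⇔ (Concatenation-cong ∈L⇔P)
  where
  L : Fin k → List (List (Fin _))
  L i = proj₁ (card i)
  L! : ∀ i → Unique (L i)
  L! i = proj₁ (proj₂ (card i))
  |L| : ∀ i → length (L i) ≡ ζ i
  |L| i = proj₁ (proj₂ (proj₂ (card i)))
  ∈L⇔P : ∀ i t → t ∈ L i ⇔ P i t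
  ∈L⇔P i = proj₂ (proj₂ (proj₂ (card i)))

DescentFreeListing : ∀ {n} → Digraph n → List (Fin n) → Set
DescentFreeListing Y τ = Listing (vert Y) τ × NoDescent Y τ

HamPath-complement⇔DescentFreeListing : ∀ {n} (Y : Digraph n) τ →
                                        HamPath (complement Y) τ ⇔ DescentFreeListing Y τ
HamPath-complement⇔DescentFreeListing Y τ = mk⇔
  (Product.map₂ (Linked.map (λ (_ , _ , _ , ¬e) → ¬e)))
  (λ (τ-listing@(τ! , _) , noDescent) →
    τ-listing , Linked-strengthen (Listing⇒All τ-listing) τ! noDescent)

module _ {n k : ℕ} (E : Fin n → Fin n → Set) (irr : ∀ {u v} → E u v → u ≢ v) (b : Fin n → Fin k) where

  private
    X : Digraph n
    X = mkDigraph E irr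

    X[_] : Fin k → Digraph n
    X[ i ] = restrict X (Block b i)

  FriendlyListing : List (Fin n) → Set
  FriendlyListing σ = Listing (λ _ → ⊤) σ × FFriendly X b σ

  FColoring-reflects-block-order : ∀ {f} → FColoring b f → ∀ {u v} → f u ≤ f v → b u F.≤ b v
  FColoring-reflects-block-order (_ , _ , f-increasing) {u} {v} fu≤fv =
    ℕ.≮⇒≥ (λ bv<bu → ℕ.<⇒≱ (f-increasing v u bv<bu) fu≤fv)

  blockIndexColoring : FColoring b (suc ∘ toℕ ∘ b)
  blockIndexColoring = (λ _ → s≤s z≤n) , (λ _ _ → cong (suc ∘ toℕ)) , (λ _ _ → s≤s)

  friendlyListing⇒DescentFreeBlocks : ∀ {σ} → FriendlyListing σ →
                                      Concatenation (λ i → DescentFreeListing X[ i ]) σ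
  friendlyListing⇒DescentFreeBlocks {σ} (σ-listing , f , f-coloring@(_ , f-constant , _) , σ-friendly) =
    τ , σ≡ , λ i → Listing-filter (λ v → b v F.≟ i) σ-listing , noDescent i
    where
    τ : Fin k → List (Fin n)
    τ i = blockOf b i σ
    σ≡ : σ ≡ concat (map τ (allFin k))
    σ≡ = sorted⇒splitsIntoBlocks b
      (Linked.Linked⇒AllPairs ℕ.≤-trans
        (Linked.map (FColoring-reflects-block-order f-coloring ∘ proj₁) σ-friendly))
      (AllPairs.tabulate⁺-< (λ i<j → i<j))
      (All.tabulate (λ {v} _ → ∈-allFin (b v)))
    noDescent : ∀ i → NoDescent X[ i ] (τ i)
    noDescent i = Linked.map
      (λ (_ , E⇒fu<fv) (e , bu≡i , bv≡i) →
        ℕ.<-irrefl (f-constant _ _ (trans bu≡i (sym bv≡i))) (E⇒fu<fv e))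
      (All.lookup (All.map⁻ (Linked-concat⁻ (map τ (allFin k)) (subst (Friendly X f) σ≡ σ-friendly)))
                  (∈-allFin i))

  HamPathBlocks⇒friendlyListing : ∀ {σ} → Concatenation (λ i → HamPath (complement X[ i ])) σ →
                                  FriendlyListing σ
  HamPathBlocks⇒friendlyListing (τ , refl , τ-ham) =
    Listing-concat-blocks b (proj₁ ∘ τ-ham) ,
    f , blockIndexColoring ,
    Linked-concat⁺ (All-map-allFin⁺ withinBlock) (AllPairs.map⁺ (AllPairs.tabulate⁺-< acrossBlocks))
    where
    f : Fin n → ℕ
    f = suc ∘ toℕ ∘ b
    inBlock : ∀ {i v} → v ∈ τ i → b v ≡ i
    inBlock {i} {v} v∈ = proj₂ (to (proj₂ (proj₁ (τ-ham i)) v) v∈)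
    withinBlock : ∀ i → Friendly X f (τ i)
    withinBlock i = Linked.map
      (λ ((_ , bu≡i) , (_ , bv≡i) , _ , ¬e) →
        ℕ.≤-reflexive (cong (suc ∘ toℕ) (trans bu≡i (sym bv≡i))) ,
        λ e → contradiction (e , bu≡i , bv≡i) ¬e)
      (proj₂ (τ-ham i))
    acrossBlocks : ∀ {i j} → i F.< j → ∀ {u v} → u ∈ τ i → v ∈ τ j →
                   f u ≤ f v × (E u v → f u < f v)
    acrossBlocks i<j u∈ v∈ =
      let fu<fv = s≤s (subst₂ F._<_ (sym (inBlock u∈)) (sym (inBlock v∈)) i<j)
      in  ℕ.<⇒≤ fu<fv , λ _ → fu<fv

  HamPathBlocks⇔DescentFreeBlocks : ∀ σ → Concatenation (λ i → HamPath (complement X[ i ])) σ ⇔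
                                          Concatenation (λ i → DescentFreeListing X[ i ]) σ
  HamPathBlocks⇔DescentFreeBlocks σ =
    Concatenation-cong (λ i → HamPath-complement⇔DescentFreeListing X[ i ])

  friendlyListing⇔HamPathBlocks : ∀ σ → FriendlyListing σ ⇔
                                        Concatenation (λ i → HamPath (complement X[ i ])) σ
  friendlyListing⇔HamPathBlocks σ = mk⇔
    (from (HamPathBlocks⇔DescentFreeBlocks σ) ∘ friendlyListing⇒DescentFreeBlocks)
    HamPathBlocks⇒friendlyListing

  friendlyListing⇔DescentFreeBlocks : ∀ σ → FriendlyListing σ ⇔
                                            Concatenation (λ i → DescentFreeListing X[ i ]) σ
  friendlyListing⇔DescentFreeBlocks σ =
    ⇔.trans (friendlyListing⇔HamPathBlocks σ) (HamPathBlocks⇔DescentFreeBlocks σ)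

mainTheorem3 : ∀ {n k} (E : Fin n → Fin n → Set) (irr : ∀ {u v} → E u v → u ≢ v)
    (b : Fin n → Fin k) → IsComposition b →
    ((σ : List (Fin n)) → Listing (λ _ → ⊤) σ →
      FFriendly (mkDigraph E irr) b σ
        ⇔ (∃[ τ ] (σ ≡ concat (map τ (allFin k)))
             × (∀ i → HamPath (complement (restrict (mkDigraph E irr) (Block b i))) (τ i))))
    × ((ζ : Fin k → ℕ) →
       (∀ i → HasCard (λ τ → Listing (vert (restrict (mkDigraph E irr) (Block b i))) τ
                               × NoDescent (restrict (mkDigraph E irr) (Block b i)) τ) (ζ i)) →
       HasCard (λ σ → Listing (λ _ → ⊤) σ × FFriendly (mkDigraph E irr) b σ)
               (product (map ζ (allFin k))))
mainTheorem3 E irr b _ =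
  (λ σ σ-listing → mk⇔ (λ σ-friendly → to (friendlyListing⇔HamPathBlocks E irr b σ) (σ-listing , σ-friendly))
                       (proj₂ ∘ from (friendlyListing⇔HamPathBlocks E irr b σ))) ,
  λ ζ card → HasCard-resp-⇔ (⇔.sym ∘ friendlyListing⇔DescentFreeBlocks E irr b)
               (HasCard-Concatenation b (All.map proj₂ ∘ Listing⇒All ∘ proj₁) card)
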